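{- Let $A$ be a $\mathbb{Z}$-torsion-free $\mathbb{Z}_{(p)}$-algebra, $\mathfrak{a}\subseteq A$ a divided-power ideal, $P, Q \in A[X]$ monic polynomials, and $N \geq 1$. If $e_n(P) \equiv e_n(Q) \pmod{\mathfrak{a}}$ for all $1 \leq n \leq N$, then $p_N(P) \equiv p_N(Q) \pmod{N\mathfrak{a}}$.
   Context: $p$ is a prime and $\mathbb{Z}_{(p)}\subseteq\mathbb{Q}$ is the ring of rationals with denominator prime to $p$. An ideal $\mathfrak{a}$ of $A$ is a divided-power ideal if $a^k/k!\in\mathfrak{a}$ (equivalently $a^k\in k!\,\mathfrak{a}$) for all $a\in\mathfrak{a}$, $k\ge1$. For a monic $Q = X^d + a_1X^{d-1}+\cdots+a_d$: $e_0(Q)=1$, $e_n(Q) = (-1)^n a_n$ for $1\le n\le d$, $e_n(Q)=0$ for $n>d$. $p_n(Q)$ is obtained by writing the power-sum symmetric function $p_n=\sum_i x_i^n$ as an integer polynomial in the elementary symmetric functions $e_1,e_2,\dots$ and substituting $e_k(Q)$ for $e_k$ (for $A$ a domain it is the sum of $n$-th powers of the roots of $Q$ with multiplicity). -}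

module Defs where

open import Level using (Level; _⊔_)
open import Algebra.Bundles using (CommutativeRing)
open import Data.Nat as ℕ using (ℕ; zero; suc)
open import Data.List using (List; []; _∷_; length)
open import Data.Product using (Σ; _×_)

module _ {c ℓ : Level} (R : CommutativeRing c ℓ) where
  open CommutativeRing R

  infixr 8 _·_
  _·_ : ℕ → Carrier → Carrier
  zero  · x = 0#
  suc n · x = x + n · x

  pow : Carrier → ℕ → Carrier
  pow x zero    = 1#
  pow x (suc n) = x * pow x n

  sgn : ℕ → Carrier
  sgn zero    = 1#
  sgn (suc n) = - sgn n

  TorsionFree : Set (c ⊔ ℓ)
  TorsionFree = ∀ (n : ℕ) (a : Carrier) → 1 ℕ.≤ n → n · a ≈ 0# → a ≈ 0#

  -- A is a Z_(p)-algebra: every integer prime to p is invertible in A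
  -- (it suffices to ask this for positive integers m with p ∤ m;
  --  the map Z_(p) → A is then unique).
  ZpAlgebra : ℕ → Set (c ⊔ ℓ)
  ZpAlgebra p = ∀ (m : ℕ) → ¬ (p ∣ m) → Σ Carrier (λ y → (m · 1#) * y ≈ 1#)
    where open import Data.Nat.Divisibility using (_∣_)
          open import Relation.Nullary using (¬_)

  record IsIdeal {i : Level} (I : Carrier → Set i) : Set (c ⊔ ℓ ⊔ i) where
    field
      respects : ∀ {x y} → x ≈ y → I x → I y
      zero∈    : I 0#
      +-closed : ∀ {x y} → I x → I y → I (x + y)
      *-closed : ∀ r {x} → I x → I (r * x)

  record IsDividedPowerIdeal {i : Level} (I : Carrier → Set i) : Set (c ⊔ ℓ ⊔ i) where
    field
      isIdeal : IsIdeal I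
      divPow  : ∀ (a : Carrier) → I a → ∀ (k : ℕ) → 1 ℕ.≤ k →
                Σ Carrier (λ b → I b × pow a k ≈ (k ℕ.!) · b)

  _≡[mod_]_ : {i : Level} → Carrier → (Carrier → Set i) → Carrier → Set i
  x ≡[mod I ] y = I (x - y)

  _≡[mod_·_]_ : {i : Level} → Carrier → ℕ → (Carrier → Set i) → Carrier → Set (c ⊔ ℓ ⊔ i)
  x ≡[mod N · I ] y = Σ Carrier (λ b → I b × (x - y) ≈ N · b)

  -- A monic polynomial  Q = X^d + a₁X^{d-1} + ... + a_d  is represented by the
  -- list of its non-leading coefficients [a₁, …, a_d]  (d = length).
  MonicPoly : Set c
  MonicPoly = List Carrier

  nth : List Carrier → ℕ → Carrier
  nth []       _       = 0#
  nth (a ∷ as) zero    = a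
  nth (a ∷ as) (suc k) = nth as k

  -- e_0(Q) = 1, e_n(Q) = (-1)^n a_n for 1 ≤ n ≤ d, e_n(Q) = 0 for n > d
  e : MonicPoly → ℕ → Carrier
  e Q zero    = 1#
  e Q (suc n) = sgn (suc n) * nth Q n

  -- Newton's identities, which express p_m as the (unique) integer polynomial
  -- in e_1, e_2, … :
  --   p_m = Σ_{i=1}^{m-1} (-1)^{i-1} e_i p_{m-i} + (-1)^{m-1} m e_m .
  -- newtonStep Q m i prev : given prev = [p_{m-i}, p_{m-i-1}, …, p_1],
  -- returns Σ_{j=i}^{m-1} (-1)^{j-1} e_j p_{m-j}.
  newtonSum : MonicPoly → ℕ → List Carrier → Carrier
  newtonSum Q i []          = 0#
  newtonSum Q i (pk ∷ rest) = (sgn (ℕ.pred i) * e Q i) * pk + newtonSum Q (suc i) rest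

  -- powerSums Q n = [p_n(Q), p_{n-1}(Q), …, p_1(Q)]
  powerSums : MonicPoly → ℕ → List Carrier
  powerSums Q zero    = []
  powerSums Q (suc n) =
    (newtonSum Q 1 (powerSums Q n) + sgn n * ((suc n · 1#) * e Q (suc n)))
    ∷ powerSums Q n

  -- p_n(Q) for n ≥ 1 (p_0 is not needed; we set it to d = deg Q)
  pw : MonicPoly → ℕ → Carrier
  pw Q zero    = length Q · 1#
  pw Q (suc n) = nth (powerSums Q (suc n)) 0

{-# OPTIONS --safe #-}
-- Let F_Q = 1 + a₁X + ⋯ + a_d X^d = ∏ (1 − xᵢ X). Newton's identities say that Σ pₙ(Q) Xⁿ is the
-- log-derivative series −X F_Q′ / F_Q. Multiplying F_Q successively by binomials 1 + aₜ Xᵗ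
-- (t = 1, …, N, aₜ ∈ 𝔞) produces a series that agrees with F_P up to degree N, and up to degree N
-- the log-derivative series only depends on the series up to degree N. Each factor adds the
-- log-derivative series of 1 + a Xᵗ, which is Σ_{q ≥ 1} t (−a)^q X^{tq}; writing (−a)^q = q! γ
-- with γ ∈ 𝔞, its coefficient t (−a)^q = tq · (q − 1)! γ lies in tq 𝔞.
module Submission where

open import Defs
open import Level using (Level; _⊔_)
open import Algebra.Bundles using (CommutativeRing)
open import Data.Nat as ℕ using (ℕ; zero; suc; _≤_; _<_; z≤n; s≤s; _!)
import Data.Nat.Properties as ℕₚ
open import Data.Nat.Induction using (<-rec)
open import Data.Nat.Primality using (Prime)
open import Data.Product using (∃-syntax; _,_) renaming (_×_ to _∧_)
open import Data.Sum using (_⊎_; inj₁; inj₂)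
open import Relation.Binary.PropositionalEquality as ≡ using (_≡_)

module _ {c ℓ : Level} (R : CommutativeRing c ℓ) where
  open CommutativeRing R
  open import Algebra.Properties.Ring ring
    using (-‿distribˡ-*; -‿distribʳ-*; -‿+-comm; -‿involutive; +-inverseˡ-unique; -1*x≈-x; x[y-z]≈xy-xz; xyx⁻¹≈y)
  open import Algebra.Properties.Semiring.Mult semiring
    using (_×_; ×-congʳ; ×-homo-+; ×-assocˡ; ×-comm-*; ×-assoc-*)
  open import Algebra.Properties.CommutativeMonoid.Mult +-commutativeMonoid using (×-distrib-+)
  open import Algebra.Properties.CommutativeSemigroup +-commutativeSemigroup using (interchange; xy∙z≈xz∙y)
  open import Algebra.Properties.CommutativeSemigroup *-commutativeSemigroup using (x∙yz≈y∙xz)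
  open import Relation.Binary.Reasoning.Setoid setoid

  ·≡× : ∀ n x → _·_ R n x ≡ n × x
  ·≡× zero    x = ≡.refl
  ·≡× (suc n) x = ≡.cong (x +_) (·≡× n x)

  ×-zeroʳ : ∀ n → n × 0# ≈ 0#
  ×-zeroʳ zero    = refl
  ×-zeroʳ (suc n) = trans (+-identityˡ _) (×-zeroʳ n)

  Series : Set c
  Series = ℕ → Carrier

  infix 4 _≋_
  _≋_ : Series → Series → Set ℓ
  f ≋ g = ∀ n → f n ≈ g n

  0ₛ : Series
  0ₛ _ = 0#

  infixl 6 _⊕_
  _⊕_ : Series → Series → Series
  (f ⊕ g) n = f n + g n

  infixr 7 _⊙_
  _⊙_ : Carrier → Series → Series
  (a ⊙ f) n = a * f n

  constant : Carrier → Series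
  constant b zero    = b
  constant b (suc _) = 0#

  tail : Series → Series
  tail f n = f (suc n)

  shift₁ : Series → Series
  shift₁ f zero    = 0#
  shift₁ f (suc n) = f n

  shift : ℕ → Series → Series
  shift zero    f = f
  shift (suc t) f = shift₁ (shift t f)

  infixl 7 _⊛_
  _⊛_ : Series → Series → Series
  (f ⊛ g) zero    = f 0 * g 0
  (f ⊛ g) (suc n) = f 0 * g (suc n) + (tail f ⊛ g) n

  -- θ = X d/dX
  θ : Series → Series
  θ f n = n × f n

  shift-< : ∀ t f {n} → n < t → shift t f n ≡ 0#
  shift-< (suc t) f {zero}  _          = ≡.refl
  shift-< (suc t) f {suc n} (s≤s n<t) = shift-< t f n<t

  shift-+ : ∀ t f m → shift t f (t ℕ.+ m) ≡ f m
  shift-+ zero    f m = ≡.refl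
  shift-+ (suc t) f m = shift-+ t f m

  shift-cong : ∀ t {f g} → f ≋ g → shift t f ≋ shift t g
  shift-cong zero    f≋g n       = f≋g n
  shift-cong (suc t) f≋g zero    = refl
  shift-cong (suc t) f≋g (suc n) = shift-cong t f≋g n

  shift-⊕ : ∀ t f g → shift t (f ⊕ g) ≋ shift t f ⊕ shift t g
  shift-⊕ zero    f g n       = refl
  shift-⊕ (suc t) f g zero    = sym (+-identityʳ 0#)
  shift-⊕ (suc t) f g (suc n) = shift-⊕ t f g n

  shift-⊙ : ∀ t a f → shift t (a ⊙ f) ≋ a ⊙ shift t f
  shift-⊙ zero    a f n       = refl
  shift-⊙ (suc t) a f zero    = sym (zeroʳ a)
  shift-⊙ (suc t) a f (suc n) = shift-⊙ t a f n

  shift-0ₛ : ∀ t {f} → f ≋ 0ₛ → shift t f ≋ 0ₛ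
  shift-0ₛ zero    f≋0 n       = f≋0 n
  shift-0ₛ (suc t) f≋0 zero    = refl
  shift-0ₛ (suc t) f≋0 (suc n) = shift-0ₛ t f≋0 n

  θ-shift : ∀ t f → θ (shift t f) ≋ shift t (θ f) ⊕ (λ n → t × shift t f n)
  θ-shift t f n with ℕₚ.<-≤-connex n t
  ... | inj₁ n<t rewrite shift-< t f n<t | shift-< t (θ f) n<t =
    trans (×-zeroʳ n) (sym (trans (+-identityˡ _) (×-zeroʳ t)))
  ... | inj₂ t≤n with ℕₚ.m≤n⇒∃[o]m+o≡n t≤n
  ...   | m , ≡.refl rewrite shift-+ t f m | shift-+ t (θ f) m =
    trans (×-homo-+ (f m) t m) (+-comm _ _)

  ⊛-cong≤ : ∀ n {f f′ g g′} → (∀ k → k ≤ n → f k ≈ f′ k) → (∀ k → k ≤ n → g k ≈ g′ k) →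
            (f ⊛ g) n ≈ (f′ ⊛ g′) n
  ⊛-cong≤ zero    f≈ g≈ = *-cong (f≈ 0 z≤n) (g≈ 0 z≤n)
  ⊛-cong≤ (suc n) f≈ g≈ = +-cong (*-cong (f≈ 0 z≤n) (g≈ (suc n) ℕₚ.≤-refl))
    (⊛-cong≤ n (λ k k≤n → f≈ (suc k) (s≤s k≤n)) (λ k k≤n → g≈ k (ℕₚ.m≤n⇒m≤1+n k≤n)))

  ⊛-0ₛʳ : ∀ f {g} → g ≋ 0ₛ → f ⊛ g ≋ 0ₛ
  ⊛-0ₛʳ f g≋0 zero    = trans (*-congˡ (g≋0 0)) (zeroʳ (f 0))
  ⊛-0ₛʳ f g≋0 (suc n) = trans (+-cong (trans (*-congˡ (g≋0 (suc n))) (zeroʳ (f 0))) (⊛-0ₛʳ (tail f) g≋0 n))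
                              (+-identityʳ 0#)

  ⊛-distribˡ-⊕ : ∀ f g h → f ⊛ (g ⊕ h) ≋ f ⊛ g ⊕ f ⊛ h
  ⊛-distribˡ-⊕ f g h zero    = distribˡ (f 0) (g 0) (h 0)
  ⊛-distribˡ-⊕ f g h (suc n) =
    trans (+-cong (distribˡ _ _ _) (⊛-distribˡ-⊕ (tail f) g h n)) (interchange _ _ _ _)

  ⊛-distribʳ-⊕ : ∀ f g h → (g ⊕ h) ⊛ f ≋ g ⊛ f ⊕ h ⊛ f
  ⊛-distribʳ-⊕ f g h zero    = distribʳ (f 0) (g 0) (h 0)
  ⊛-distribʳ-⊕ f g h (suc n) =
    trans (+-cong (distribʳ _ _ _) (⊛-distribʳ-⊕ f (tail g) (tail h) n)) (interchange _ _ _ _)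

  ⊛-⊙ˡ : ∀ a f g → (a ⊙ f) ⊛ g ≋ a ⊙ (f ⊛ g)
  ⊛-⊙ˡ a f g zero    = *-assoc a (f 0) (g 0)
  ⊛-⊙ˡ a f g (suc n) = trans (+-cong (*-assoc _ _ _) (⊛-⊙ˡ a (tail f) g n)) (sym (distribˡ _ _ _))

  ⊛-⊙ʳ : ∀ a f g → f ⊛ (a ⊙ g) ≋ a ⊙ (f ⊛ g)
  ⊛-⊙ʳ a f g zero    = x∙yz≈y∙xz (f 0) a (g 0)
  ⊛-⊙ʳ a f g (suc n) = trans (+-cong (x∙yz≈y∙xz _ _ _) (⊛-⊙ʳ a (tail f) g n)) (sym (distribˡ _ _ _))

  ⊛-constantʳ : ∀ f b → f ⊛ constant b ≋ b ⊙ f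
  ⊛-constantʳ f b zero    = *-comm (f 0) b
  ⊛-constantʳ f b (suc n) = trans (+-cong (zeroʳ (f 0)) (⊛-constantʳ (tail f) b n)) (+-identityˡ _)

  ⊛-unfold : ∀ f g → f ⊛ g ≋ f 0 ⊙ g ⊕ shift₁ (tail f ⊛ g)
  ⊛-unfold f g zero    = sym (+-identityʳ _)
  ⊛-unfold f g (suc n) = refl

  ⊛-shift₁ˡ : ∀ f g → shift₁ f ⊛ g ≋ shift₁ (f ⊛ g)
  ⊛-shift₁ˡ f g zero    = zeroˡ (g 0)
  ⊛-shift₁ˡ f g (suc n) = trans (+-congʳ (zeroˡ _)) (+-identityˡ _)

  ⊛-shift₁ʳ : ∀ f g → f ⊛ shift₁ g ≋ shift₁ (f ⊛ g)
  ⊛-shift₁ʳ f g zero    = zeroʳ (f 0)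
  ⊛-shift₁ʳ f g (suc n) = trans (+-congˡ (⊛-shift₁ʳ (tail f) g n)) (sym (⊛-unfold f g n))

  ⊛-shiftˡ : ∀ t f g → shift t f ⊛ g ≋ shift t (f ⊛ g)
  ⊛-shiftˡ zero    f g n = refl
  ⊛-shiftˡ (suc t) f g n = trans (⊛-shift₁ˡ (shift t f) g n) (shift-cong 1 (⊛-shiftˡ t f g) n)

  ⊛-shiftʳ : ∀ t f g → f ⊛ shift t g ≋ shift t (f ⊛ g)
  ⊛-shiftʳ zero    f g n = refl
  ⊛-shiftʳ (suc t) f g n = trans (⊛-shift₁ʳ f (shift t g) n) (shift-cong 1 (⊛-shiftʳ t f g) n)

  mulBinomial : Carrier → ℕ → Series → Series
  mulBinomial a t f = f ⊕ a ⊙ shift t f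

  ⊛-mulBinomialˡ : ∀ a t f g → mulBinomial a t f ⊛ g ≋ mulBinomial a t (f ⊛ g)
  ⊛-mulBinomialˡ a t f g n = begin
    (mulBinomial a t f ⊛ g) n            ≈⟨ ⊛-distribʳ-⊕ g f (a ⊙ shift t f) n ⟩
    (f ⊛ g) n + ((a ⊙ shift t f) ⊛ g) n  ≈⟨ +-congˡ (⊛-⊙ˡ a (shift t f) g n) ⟩
    (f ⊛ g) n + a * (shift t f ⊛ g) n    ≈⟨ +-congˡ (*-congˡ (⊛-shiftˡ t f g n)) ⟩
    (f ⊛ g) n + a * shift t (f ⊛ g) n    ∎

  ⊛-mulBinomialʳ : ∀ a t f g → f ⊛ mulBinomial a t g ≋ mulBinomial a t (f ⊛ g)
  ⊛-mulBinomialʳ a t f g n = begin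
    (f ⊛ mulBinomial a t g) n            ≈⟨ ⊛-distribˡ-⊕ f g (a ⊙ shift t g) n ⟩
    (f ⊛ g) n + (f ⊛ (a ⊙ shift t g)) n  ≈⟨ +-congˡ (⊛-⊙ʳ a f (shift t g) n) ⟩
    (f ⊛ g) n + a * (f ⊛ shift t g) n    ≈⟨ +-congˡ (*-congˡ (⊛-shiftʳ t f g n)) ⟩
    (f ⊛ g) n + a * shift t (f ⊛ g) n    ∎

  mulBinomial-⊕ : ∀ a t f g → mulBinomial a t (f ⊕ g) ≋ mulBinomial a t f ⊕ mulBinomial a t g
  mulBinomial-⊕ a t f g n =
    trans (+-congˡ (trans (*-congˡ (shift-⊕ t f g n)) (distribˡ _ _ _))) (interchange _ _ _ _)

  mulBinomial-0ₛ : ∀ a t {f} → f ≋ 0ₛ → mulBinomial a t f ≋ 0ₛ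
  mulBinomial-0ₛ a t f≋0 n =
    trans (+-cong (f≋0 n) (trans (*-congˡ (shift-0ₛ t f≋0 n)) (zeroʳ a))) (+-identityʳ 0#)

  θ-mulBinomial : ∀ a t f → θ (mulBinomial a t f) ≋ mulBinomial a t (θ f) ⊕ (t × a) ⊙ shift t f
  θ-mulBinomial a t f n = begin
    n × (f n + a * s)                              ≈⟨ ×-distrib-+ (f n) (a * s) n ⟩
    n × f n + n × (a * s)                          ≈⟨ +-congˡ (sym (×-comm-* n a s)) ⟩
    n × f n + a * θ (shift t f) n                  ≈⟨ +-congˡ (*-congˡ (θ-shift t f n)) ⟩
    n × f n + a * (shift t (θ f) n + t × s)        ≈⟨ +-congˡ (distribˡ _ _ _) ⟩
    n × f n + (a * shift t (θ f) n + a * (t × s))  ≈⟨ sym (+-assoc _ _ _) ⟩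
    n × f n + a * shift t (θ f) n + a * (t × s)    ≈⟨ +-congˡ (×-comm-* t a s) ⟩
    n × f n + a * shift t (θ f) n + t × (a * s)    ≈⟨ +-congˡ (sym (×-assoc-* t a s)) ⟩
    n × f n + a * shift t (θ f) n + (t × a) * s    ∎
    where
    s : Carrier
    s = shift t f n

  -- X = −X·G′/G, stated without division; for G = ∏ (1 − xᵢ X) this is X = Σ pₙ Xⁿ.
  IsLogDerivative : Series → Series → Set ℓ
  IsLogDerivative G X = G ⊛ X ⊕ θ G ≋ 0ₛ

  -- The second hypothesis says that M is the log-derivative series of 1 + a Xᵗ.
  IsLogDerivative-mulBinomial : ∀ a t {H X M} → IsLogDerivative H X →
    mulBinomial a t M ⊕ shift t (constant (t × a)) ≋ 0ₛ →
    IsLogDerivative (mulBinomial a t H) (X ⊕ M)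
  IsLogDerivative-mulBinomial a t {H} {X} {M} H-log M-log n = begin
    (L H ⊛ (X ⊕ M)) n + θ (L H) n
      ≈⟨ +-cong (⊛-distribˡ-⊕ (L H) X M n) (θ-mulBinomial a t H n) ⟩
    ((L H ⊛ X) n + (L H ⊛ M) n) + (L (θ H) n + (t × a) * shift t H n)
      ≈⟨ interchange _ _ _ _ ⟩
    ((L H ⊛ X) n + L (θ H) n) + ((L H ⊛ M) n + (t × a) * shift t H n)
      ≈⟨ +-cong (+-congʳ (⊛-mulBinomialˡ a t H X n))
                (+-cong (trans (⊛-mulBinomialˡ a t H M n) (sym (⊛-mulBinomialʳ a t H M n))) monomial) ⟩
    (L (H ⊛ X) n + L (θ H) n) + ((H ⊛ L M) n + (H ⊛ shift t (constant (t × a))) n)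
      ≈⟨ +-cong (sym (mulBinomial-⊕ a t (H ⊛ X) (θ H) n))
                (sym (⊛-distribˡ-⊕ H (L M) (shift t (constant (t × a))) n)) ⟩
    L (H ⊛ X ⊕ θ H) n + (H ⊛ (L M ⊕ shift t (constant (t × a)))) n
      ≈⟨ +-cong (mulBinomial-0ₛ a t H-log n) (⊛-0ₛʳ H M-log n) ⟩
    0# + 0#
      ≈⟨ +-identityʳ 0# ⟩
    0# ∎
    where
    L : Series → Series
    L = mulBinomial a t

    monomial : (t × a) * shift t H n ≈ (H ⊛ shift t (constant (t × a))) n
    monomial = sym (begin
      (H ⊛ shift t (constant (t × a))) n  ≈⟨ ⊛-shiftʳ t H (constant (t × a)) n ⟩
      shift t (H ⊛ constant (t × a)) n    ≈⟨ shift-cong t (⊛-constantʳ H (t × a)) n ⟩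
      shift t ((t × a) ⊙ H) n             ≈⟨ shift-⊙ t (t × a) H n ⟩
      (t × a) * shift t H n               ∎)

  IsLogDerivative-recurrence : ∀ {G X} → G 0 ≈ 1# → IsLogDerivative G X →
    X ≋ λ n → - (shift₁ (tail G ⊛ X) n + θ G n)
  IsLogDerivative-recurrence {G} {X} G₀≈1 X-log n = +-inverseˡ-unique (X n) _ (begin
    X n + (shift₁ (tail G ⊛ X) n + θ G n)      ≈⟨ sym (+-assoc _ _ _) ⟩
    X n + shift₁ (tail G ⊛ X) n + θ G n        ≈⟨ +-congʳ (+-congʳ (sym (trans (*-congʳ G₀≈1) (*-identityˡ (X n))))) ⟩
    G 0 * X n + shift₁ (tail G ⊛ X) n + θ G n  ≈⟨ +-congʳ (sym (⊛-unfold G X n)) ⟩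
    (G ⊛ X) n + θ G n                          ≈⟨ X-log n ⟩
    0#                                         ∎)

  IsLogDerivative-unique≤ : ∀ {G G′ X X′} N → G 0 ≈ 1# → (∀ n → n ≤ N → G n ≈ G′ n) →
    IsLogDerivative G X → IsLogDerivative G′ X′ → ∀ n → n ≤ N → X n ≈ X′ n
  IsLogDerivative-unique≤ {G} {G′} {X} {X′} N G₀≈1 G≈G′ X-log X′-log = <-rec _ step
    where
    G′₀≈1 : G′ 0 ≈ 1#
    G′₀≈1 = trans (sym (G≈G′ 0 z≤n)) G₀≈1

    tails-agree : ∀ n → (∀ {m} → m < n → m ≤ N → X m ≈ X′ m) → n ≤ N →
                  shift₁ (tail G ⊛ X) n ≈ shift₁ (tail G′ ⊛ X′) n
    tails-agree zero    _  _   = refl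
    tails-agree (suc n) ih n≤N = ⊛-cong≤ n
      (λ k k≤n → G≈G′ (suc k) (ℕₚ.≤-trans (s≤s k≤n) n≤N))
      (λ k k≤n → ih (s≤s k≤n) (ℕₚ.≤-trans (ℕₚ.m≤n⇒m≤1+n k≤n) n≤N))

    step : ∀ n → (∀ {m} → m < n → m ≤ N → X m ≈ X′ m) → n ≤ N → X n ≈ X′ n
    step n ih n≤N = begin
      X n                                    ≈⟨ IsLogDerivative-recurrence G₀≈1 X-log n ⟩
      - (shift₁ (tail G ⊛ X) n + θ G n)      ≈⟨ -‿cong (+-cong (tails-agree n ih n≤N) (×-congʳ n (G≈G′ n n≤N))) ⟩
      - (shift₁ (tail G′ ⊛ X′) n + θ G′ n)   ≈⟨ sym (IsLogDerivative-recurrence G′₀≈1 X′-log n) ⟩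
      X′ n                                   ∎

  module _ (a : Carrier) (s : ℕ) where

    -- geometric k = Xᵏ · t(−a) / (1 + a Xᵗ), where t = 1 + s.
    geometric : ℕ → Series
    geometric zero    zero    = suc s × (- a)
    geometric zero    (suc n) = - a * geometric s n
    geometric (suc k) zero    = 0#
    geometric (suc k) (suc n) = geometric k n

    logBinomial : Series
    logBinomial = geometric (suc s)

    geometric-recurrence : ∀ k →
      geometric k ⊕ a ⊙ shift k logBinomial ⊕ shift k (constant (suc s × a)) ≋ 0ₛ
    geometric-recurrence zero zero = begin
      suc s × (- a) + a * 0# + suc s × a  ≈⟨ +-congʳ (trans (+-congˡ (zeroʳ a)) (+-identityʳ _)) ⟩
      suc s × (- a) + suc s × a           ≈⟨ sym (×-distrib-+ (- a) a (suc s)) ⟩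
      suc s × (- a + a)                   ≈⟨ ×-congʳ (suc s) (-‿inverseˡ a) ⟩
      suc s × 0#                          ≈⟨ ×-zeroʳ (suc s) ⟩
      0#                                  ∎
    geometric-recurrence zero (suc n) = begin
      - a * geometric s n + a * geometric s n + 0#  ≈⟨ +-identityʳ _ ⟩
      - a * geometric s n + a * geometric s n       ≈⟨ sym (distribʳ _ _ _) ⟩
      (- a + a) * geometric s n                     ≈⟨ *-congʳ (-‿inverseˡ a) ⟩
      0# * geometric s n                            ≈⟨ zeroˡ _ ⟩
      0#                                            ∎
    geometric-recurrence (suc k) zero    = trans (+-identityʳ _) (trans (+-identityˡ _) (zeroʳ a))
    geometric-recurrence (suc k) (suc n) = geometric-recurrence k n

    logBinomial-isLog : mulBinomial a (suc s) logBinomial ⊕ shift (suc s) (constant (suc s × a)) ≋ 0ₛ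
    logBinomial-isLog = geometric-recurrence (suc s)

    geometric-shape : ∀ k n → geometric k n ≈ 0# ⊎
      ∃[ q ] (n ≡ k ℕ.+ suc s ℕ.* q ∧ geometric k n ≈ suc s × pow R (- a) (suc q))
    geometric-shape zero zero =
      inj₂ (0 , ≡.sym (ℕₚ.*-zeroʳ (suc s)) , ×-congʳ (suc s) (sym (*-identityʳ (- a))))
    geometric-shape zero (suc n) with geometric-shape s n
    ... | inj₁ ≈0 = inj₁ (trans (*-congˡ ≈0) (zeroʳ (- a)))
    ... | inj₂ (q , ≡.refl , ≈v) =
      inj₂ (suc q , ≡.sym (ℕₚ.*-suc (suc s) q) , trans (*-congˡ ≈v) (×-comm-* (suc s) (- a) _))
    geometric-shape (suc k) zero = inj₁ refl
    geometric-shape (suc k) (suc n) with geometric-shape k n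
    ... | inj₁ ≈0                = inj₁ ≈0
    ... | inj₂ (q , ≡.refl , ≈v) = inj₂ (q , ≡.refl , ≈v)

  sgn-cancel : ∀ n x → sgn R n * (sgn R n * x) ≈ x
  sgn-cancel zero    x = trans (*-identityˡ _) (*-identityˡ x)
  sgn-cancel (suc n) x = begin
    - σ * (- σ * x)    ≈⟨ *-congˡ (sym (-‿distribˡ-* σ x)) ⟩
    - σ * - (σ * x)    ≈⟨ sym (-‿distribˡ-* σ _) ⟩
    - (σ * - (σ * x))  ≈⟨ -‿cong (sym (-‿distribʳ-* σ _)) ⟩
    - - (σ * (σ * x))  ≈⟨ -‿involutive _ ⟩
    σ * (σ * x)        ≈⟨ sgn-cancel n x ⟩
    x                  ∎
    where
    σ : Carrier
    σ = sgn R n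

  sgn*e : ∀ Q n → sgn R n * e R Q (suc n) ≈ - nth R Q n
  sgn*e Q n = begin
    σ * (- σ * nth R Q n)    ≈⟨ *-congˡ (sym (-‿distribˡ-* σ _)) ⟩
    σ * - (σ * nth R Q n)    ≈⟨ sym (-‿distribʳ-* σ _) ⟩
    - (σ * (σ * nth R Q n))  ≈⟨ -‿cong (sgn-cancel n _) ⟩
    - nth R Q n              ∎
    where
    σ : Carrier
    σ = sgn R n

  -- For Q = ∏ (X − xᵢ) this is ∏ (1 − xᵢ X).
  coefficients : MonicPoly R → Series
  coefficients Q zero    = 1#
  coefficients Q (suc k) = nth R Q k

  -- The constant term is 0 here rather than deg Q as in pw, hence N ≥ 1 in pw-≡.
  powerSumSeries : MonicPoly R → Series
  powerSumSeries Q zero    = 0#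
  powerSumSeries Q (suc n) = pw R Q (suc n)

  newtonSum-cancel : ∀ Q i j f → (∀ k → f k ≈ nth R Q (i ℕ.+ k)) →
    newtonSum R Q (suc i) (powerSums R Q j) + (f ⊛ powerSumSeries Q) j ≈ 0#
  newtonSum-cancel Q i zero    f f≈ = trans (+-identityˡ _) (zeroʳ (f 0))
  newtonSum-cancel Q i (suc j) f f≈ = begin
    (σe * p + rest) + (f 0 * p + (tail f ⊛ powerSumSeries Q) j)
      ≈⟨ interchange _ _ _ _ ⟩
    (σe * p + f 0 * p) + (rest + (tail f ⊛ powerSumSeries Q) j)
      ≈⟨ +-cong (sym (distribʳ p σe (f 0))) (newtonSum-cancel Q (suc i) j (tail f) f≈′) ⟩
    (σe + f 0) * p + 0#
      ≈⟨ +-congʳ (*-congʳ (+-cong (sgn*e Q i) f₀≈)) ⟩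
    (- nth R Q i + nth R Q i) * p + 0#
      ≈⟨ trans (+-identityʳ _) (trans (*-congʳ (-‿inverseˡ _)) (zeroˡ p)) ⟩
    0# ∎
    where
    σe p rest : Carrier
    σe   = sgn R i * e R Q (suc i)
    p    = pw R Q (suc j)
    rest = newtonSum R Q (suc (suc i)) (powerSums R Q j)

    f₀≈ : f 0 ≈ nth R Q i
    f₀≈ = trans (f≈ 0) (reflexive (≡.cong (nth R Q) (ℕₚ.+-identityʳ i)))
    f≈′ : ∀ k → f (suc k) ≈ nth R Q (suc i ℕ.+ k)
    f≈′ k = trans (f≈ (suc k)) (reflexive (≡.cong (nth R Q) (ℕₚ.+-suc i k)))

  newton : ∀ Q → IsLogDerivative (coefficients Q) (powerSumSeries Q)
  newton Q zero    = trans (+-identityʳ _) (zeroʳ 1#)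
  newton Q (suc m) = begin
    1# * (rest + lead) + C + suc m × nth R Q m   ≈⟨ +-congʳ (+-congʳ (*-identityˡ _)) ⟩
    rest + lead + C + suc m × nth R Q m          ≈⟨ +-congʳ (xy∙z≈xz∙y rest lead C) ⟩
    rest + C + lead + suc m × nth R Q m          ≈⟨ +-assoc _ _ _ ⟩
    rest + C + (lead + suc m × nth R Q m)        ≈⟨ +-cong (newtonSum-cancel Q 0 m (tail (coefficients Q)) (λ _ → refl))
                                                           lead-cancel ⟩
    0# + 0#                                      ≈⟨ +-identityʳ 0# ⟩
    0#                                           ∎
    where
    rest lead C : Carrier
    rest = newtonSum R Q 1 (powerSums R Q m)
    lead = sgn R m * (_·_ R (suc m) 1# * e R Q (suc m))
    C    = (tail (coefficients Q) ⊛ powerSumSeries Q) m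

    lead-cancel : lead + suc m × nth R Q m ≈ 0#
    lead-cancel = begin
      lead + suc m × nth R Q m                            ≈⟨ +-congʳ (x∙yz≈y∙xz _ _ _) ⟩
      _·_ R (suc m) 1# * (sgn R m * e R Q (suc m)) + _    ≈⟨ +-congʳ (*-congˡ (sgn*e Q m)) ⟩
      _·_ R (suc m) 1# * - nth R Q m + _                  ≈⟨ +-congʳ (sym (-‿distribʳ-* _ _)) ⟩
      - (_·_ R (suc m) 1# * nth R Q m) + _                ≈⟨ +-congʳ (-‿cong (*-congʳ (reflexive (·≡× (suc m) 1#)))) ⟩
      - ((suc m × 1#) * nth R Q m) + _                    ≈⟨ +-congʳ (-‿cong (×-assoc-* (suc m) 1# _)) ⟩
      - (suc m × (1# * nth R Q m)) + _                    ≈⟨ +-congʳ (-‿cong (×-congʳ (suc m) (*-identityˡ _))) ⟩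
      - (suc m × nth R Q m) + suc m × nth R Q m           ≈⟨ -‿inverseˡ _ ⟩
      0#                                                  ∎

  module _ {i : Level} {𝔞 : Carrier → Set i} (𝔞-dp : IsDividedPowerIdeal R 𝔞) where
    open IsDividedPowerIdeal 𝔞-dp
    open IsIdeal isIdeal

    -‿closed : ∀ {x} → 𝔞 x → 𝔞 (- x)
    -‿closed x∈ = respects (-1*x≈-x _) (*-closed (- 1#) x∈)

    ×-closed : ∀ n {x} → 𝔞 x → 𝔞 (n × x)
    ×-closed zero    _  = zero∈
    ×-closed (suc n) x∈ = +-closed x∈ (×-closed n x∈)

    coefficients-≡ : ∀ P Q N → (∀ n → 1 ≤ n → n ≤ N → _≡[mod_]_ R (e R P n) 𝔞 (e R Q n)) →
                     ∀ n → n ≤ N → 𝔞 (coefficients P n - coefficients Q n)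
    coefficients-≡ P Q N P≡Q zero    _   = respects (sym (-‿inverseʳ 1#)) zero∈
    coefficients-≡ P Q N P≡Q (suc k) k<N = respects (begin
      σ * (σ * nth R P k - σ * nth R Q k)  ≈⟨ *-congˡ (sym (x[y-z]≈xy-xz σ _ _)) ⟩
      σ * (σ * (nth R P k - nth R Q k))    ≈⟨ sgn-cancel (suc k) _ ⟩
      nth R P k - nth R Q k                ∎) (*-closed σ (P≡Q (suc k) (s≤s z≤n) k<N))
      where
      σ : Carrier
      σ = sgn R (suc k)

    infix 4 _∈_·𝔞
    _∈_·𝔞 : Carrier → ℕ → Set (c ⊔ ℓ ⊔ i)
    x ∈ n ·𝔞 = ∃[ b ] (𝔞 b ∧ x ≈ n × b)

    ∈·𝔞-resp : ∀ {x y} n → x ≈ y → x ∈ n ·𝔞 → y ∈ n ·𝔞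
    ∈·𝔞-resp n x≈y (b , b∈ , x≈nb) = b , b∈ , trans (sym x≈y) x≈nb

    ∈·𝔞-+ : ∀ {x y} n → x ∈ n ·𝔞 → y ∈ n ·𝔞 → x + y ∈ n ·𝔞
    ∈·𝔞-+ n (b , b∈ , x≈) (b′ , b′∈ , y≈) =
      b + b′ , +-closed b∈ b′∈ , trans (+-cong x≈ y≈) (sym (×-distrib-+ b b′ n))

    0∈·𝔞 : ∀ n → 0# ∈ n ·𝔞
    0∈·𝔞 n = 0# , zero∈ , sym (×-zeroʳ n)

    -- With x^{q+1} = (q+1)! γ, the quotient is q! γ.
    ×-pow-∈·𝔞 : ∀ {x} → 𝔞 x → ∀ t q → t × pow R x (suc q) ∈ (t ℕ.* suc q) ·𝔞
    ×-pow-∈·𝔞 x∈ t q with divPow _ x∈ (suc q) (s≤s z≤n)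
    ... | γ , γ∈ , x^≈ = (q !) × γ , ×-closed (q !) γ∈ , (begin
      t × pow R _ (suc q)              ≈⟨ ×-congʳ t x^≈ ⟩
      t × _·_ R (suc q !) γ            ≡⟨ ≡.cong (t ×_) (·≡× (suc q !) γ) ⟩
      t × ((suc q !) × γ)              ≈⟨ ×-assocˡ γ t (suc q !) ⟩
      (t ℕ.* (suc q ℕ.* (q !))) × γ    ≡⟨ ≡.cong (_× γ) (≡.sym (ℕₚ.*-assoc t (suc q) (q !))) ⟩
      (t ℕ.* suc q ℕ.* (q !)) × γ      ≈⟨ sym (×-assocˡ γ (t ℕ.* suc q) (q !)) ⟩
      (t ℕ.* suc q) × ((q !) × γ)      ∎)

    logBinomial-∈·𝔞 : ∀ {a} → 𝔞 a → ∀ s n → logBinomial a s n ∈ n ·𝔞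
    logBinomial-∈·𝔞 {a} a∈ s n with geometric-shape a s (suc s) n
    ... | inj₁ ≈0                = ∈·𝔞-resp n (sym ≈0) (0∈·𝔞 n)
    ... | inj₂ (q , ≡.refl , ≈v) = ∈·𝔞-resp (suc s ℕ.+ suc s ℕ.* q) (sym ≈v)
      (≡.subst (λ m → suc s × pow R (- a) (suc q) ∈ m ·𝔞) (ℕₚ.*-suc (suc s) q)
               (×-pow-∈·𝔞 (-‿closed a∈) (suc s) q))

    module Approximations {G X G′ : Series} (N : ℕ) (G₀≈1 : G 0 ≈ 1#) (G′₀≈1 : G′ 0 ≈ 1#)
      (X-log : IsLogDerivative G X) (G≡G′ : ∀ n → n ≤ N → 𝔞 (G′ n - G n)) where

      -- H = G · ∏_{1 ≤ t ≤ k} (1 + aₜ Xᵗ) with aₜ ∈ 𝔞, and Z is its log-derivative series.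
      record Approximation (k : ℕ) : Set (c ⊔ ℓ ⊔ i) where
        field
          H Z    : Series
          agrees : ∀ n → n ≤ k → H n ≈ G′ n
          close  : ∀ n → n ≤ N → 𝔞 (G′ n - H n)
          Z-log  : IsLogDerivative H Z
          Z≡X    : Z N - X N ∈ N ·𝔞

      initial : Approximation 0
      initial = record
        { H      = G
        ; Z      = X
        ; agrees = λ { .0 z≤n → trans G₀≈1 (sym G′₀≈1) }
        ; close  = G≡G′
        ; Z-log  = X-log
        ; Z≡X    = ∈·𝔞-resp N (sym (-‿inverseʳ (X N))) (0∈·𝔞 N)
        }

      refine : ∀ {k} → suc k ≤ N → Approximation k → Approximation (suc k)
      refine {k} k<N A = record
        { H      = mulBinomial a t H
        ; Z      = Z ⊕ logBinomial a k
        ; agrees = agrees′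
        ; close  = close′
        ; Z-log  = IsLogDerivative-mulBinomial a t Z-log (logBinomial-isLog a k)
        ; Z≡X    = ∈·𝔞-resp N (sym (xy∙z≈xz∙y (Z N) (logBinomial a k N) (- X N)))
                     (∈·𝔞-+ N Z≡X (logBinomial-∈·𝔞 a∈ k N))
        }
        where
        open Approximation A

        t : ℕ
        t = suc k

        a : Carrier
        a = G′ t - H t

        a∈ : 𝔞 a
        a∈ = close t k<N

        agrees′ : ∀ n → n ≤ t → H n + a * shift t H n ≈ G′ n
        agrees′ n n≤t with ℕₚ.m≤n⇒m<n∨m≡n n≤t
        ... | inj₁ n<t@(s≤s n≤k) = begin
          H n + a * shift t H n  ≡⟨ ≡.cong (λ x → H n + a * x) (shift-< t H n<t) ⟩
          H n + a * 0#           ≈⟨ trans (+-congˡ (zeroʳ a)) (+-identityʳ _) ⟩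
          H n                    ≈⟨ agrees n n≤k ⟩
          G′ n                   ∎
        ... | inj₂ ≡.refl = begin
          H t + a * shift t H t  ≡⟨ ≡.cong (λ x → H t + a * x) shift-t≡H₀ ⟩
          H t + a * H 0          ≈⟨ +-congˡ (trans (*-congˡ (trans (agrees 0 z≤n) G′₀≈1)) (*-identityʳ a)) ⟩
          H t + (G′ t - H t)     ≈⟨ sym (+-assoc _ _ _) ⟩
          H t + G′ t - H t       ≈⟨ xyx⁻¹≈y (H t) (G′ t) ⟩
          G′ t                   ∎
          where
          shift-t≡H₀ : shift t H t ≡ H 0
          shift-t≡H₀ = ≡.trans (≡.cong (shift t H) (≡.sym (ℕₚ.+-identityʳ t))) (shift-+ t H 0)

        close′ : ∀ n → n ≤ N → 𝔞 (G′ n - (H n + a * shift t H n))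
        close′ n n≤N = respects (begin
          G′ n - H n - a * shift t H n        ≈⟨ +-assoc _ _ _ ⟩
          G′ n + (- H n - a * shift t H n)    ≈⟨ +-congˡ (-‿+-comm _ _) ⟩
          G′ n - (H n + a * shift t H n)      ∎)
          (+-closed (close n n≤N) (-‿closed (respects (*-comm _ a) (*-closed (shift t H n) a∈))))

      approximation : ∀ k → k ≤ N → Approximation k
      approximation zero    _   = initial
      approximation (suc k) k<N = refine k<N (approximation k (ℕₚ.<⇒≤ k<N))

    IsLogDerivative-≡ : ∀ {G X G′ X′} N → G 0 ≈ 1# → G′ 0 ≈ 1# →
      IsLogDerivative G X → IsLogDerivative G′ X′ → (∀ n → n ≤ N → 𝔞 (G′ n - G n)) →
      X′ N - X N ∈ N ·𝔞
    IsLogDerivative-≡ N G₀≈1 G′₀≈1 X-log X′-log G≡G′ =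
      ∈·𝔞-resp N (+-congʳ (IsLogDerivative-unique≤ N H₀≈1 agrees Z-log X′-log N ℕₚ.≤-refl)) Z≡X
      where
      open Approximations N G₀≈1 G′₀≈1 X-log G≡G′
      open Approximation (approximation N ℕₚ.≤-refl)
      H₀≈1 : H 0 ≈ 1#
      H₀≈1 = trans (agrees 0 z≤n) G′₀≈1

    pw-≡ : ∀ P Q N → 1 ≤ N → (∀ n → 1 ≤ n → n ≤ N → _≡[mod_]_ R (e R P n) 𝔞 (e R Q n)) →
           _≡[mod_·_]_ R (pw R P N) N 𝔞 (pw R Q N)
    pw-≡ P Q (suc N) _ P≡Q
      with IsLogDerivative-≡ (suc N) refl refl (newton Q) (newton P) (coefficients-≡ P Q (suc N) P≡Q)
    ... | b , b∈ , P-Q≈ = b , b∈ , trans P-Q≈ (reflexive (≡.sym (·≡× (suc N) b)))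

proposition2p10 : ∀ {c ℓ i : Level} (R : CommutativeRing c ℓ) (p : ℕ) → Prime p →
    TorsionFree R → ZpAlgebra R p →
    (𝔞 : CommutativeRing.Carrier R → Set i) → IsDividedPowerIdeal R 𝔞 →
    (P Q : MonicPoly R) (N : ℕ) → 1 ≤ N →
    (∀ (n : ℕ) → 1 ≤ n → n ≤ N → _≡[mod_]_ R (e R P n) 𝔞 (e R Q n)) →
    _≡[mod_·_]_ R (pw R P N) N 𝔞 (pw R Q N)
proposition2p10 R _ _ _ _ 𝔞 𝔞-dp = pw-≡ R 𝔞-dp
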